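{- Let $A$ be a set of actions containing $\tau$, $(S,\to)$ a labelled transition system with labels from $A$, and $R_1,R_2$ binary relations on $S$, with composition $R_1;R_2=\{(s,u)\mid\exists t.\ sR_1t\text{ and }tR_2u\}$. (i) If $R_1$ and $R_2$ both satisfy (T), then so does $R_1;R_2$. (ii) If $R_1$ and $R_2$ both satisfy (D$_3$), then so does $R_1;R_2$.
   Context: $s\xrightarrow{a}s'$ means $(s,a,s')\in\to$; $s\xrightarrow{(a)}s'$ means "$s\xrightarrow{a}s'$, or ($a=\tau$ and $s=s'$)"; $\twoheadrightarrow$ is the reflexive–transitive closure of $\xrightarrow{\tau}$; $\omega=\{0,1,\dots\}$. For a binary relation $R$ on $S$: (T) if $sRt$ and $s\xrightarrow{a}s'$, then there are $t'',t'$ with $t\twoheadrightarrow t''\xrightarrow{(a)}t'$, $sRt''$ and $s'Rt'$. (D$_3$) if $sRt$ and $(s_k)_{k\in\omega}$ is an infinite sequence with $s=s_0$ and $s_k\xrightarrow{\tau}s_{k+1}$ for all $k$, then there are an infinite sequence $(t_\ell)_{\ell\in\omega}$ and a map $\sigma:\omega\to\omega$ with $t=t_0$, $t_\ell\xrightarrow{\tau}t_{\ell+1}$ and $s_{\sigma(\ell)}Rt_\ell$ for all $\ell$. -}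

module Defs where

open import Data.Nat using (ℕ; suc)
open import Data.Product using (Σ; ∃; _×_; _,_)
open import Data.Sum using (_⊎_)
open import Relation.Binary.PropositionalEquality using (_≡_)
open import Relation.Binary.Construct.Closure.ReflexiveTransitive using (Star)

record LTS (A : Set) (τ : A) : Set₁ where
  field
    S   : Set
    _⟶[_]_ : S → A → S → Set

module _ {A : Set} {τ : A} (L : LTS A τ) where
  open LTS L

  _⟶⦅_⦆_ : S → A → S → Set
  s ⟶⦅ a ⦆ s' = (s ⟶[ a ] s') ⊎ (a ≡ τ × s ≡ s')

  _↠_ : S → S → Set
  _↠_ = Star (λ x y → x ⟶[ τ ] y)

  CondT : (S → S → Set) → Set
  CondT R = ∀ {s t a s'} → R s t → s ⟶[ a ] s' →
    ∃ λ t'' → ∃ λ t' → (t ↠ t'') × (t'' ⟶⦅ a ⦆ t') × R s t'' × R s' t'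

  CondD3 : (S → S → Set) → Set
  CondD3 R = ∀ {s t} → R s t → (ss : ℕ → S) → ss 0 ≡ s →
    (∀ k → ss k ⟶[ τ ] ss (suc k)) →
    Σ (ℕ → S) λ ts → Σ (ℕ → ℕ) λ σ →
      (ts 0 ≡ t) × (∀ ℓ → ts ℓ ⟶[ τ ] ts (suc ℓ)) × (∀ ℓ → R (ss (σ ℓ)) (ts ℓ))

_⨾_ : {S : Set} → (S → S → Set) → (S → S → Set) → (S → S → Set)
(R₁ ⨾ R₂) s u = ∃ λ t → R₁ s t × R₂ t u

-- For (T), a step of s is answered
-- by R₁ with t ↠ t'' ⟶⦅a⦆ t'; R₂ then replays the τ-path t ↠ t'' step by step (each τ-step
-- answered by a τ-path of u), and finally answers t'' ⟶ t' itself unless that optional step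
-- is empty. For (D₃), R₁ turns the divergence of s into a divergence of t, which R₂ turns
-- into a divergence of u; the index maps compose.
module Submission where

open import Defs
open import Data.Product using (∃; _×_; _,_)
open import Data.Sum using (inj₁; inj₂)
open import Relation.Binary.PropositionalEquality using (refl)
open import Relation.Binary.Construct.Closure.ReflexiveTransitive using (ε; _◅_; _◅◅_)
open import Function using (_∘_)

module _ {A : Set} {τ : A} (L : LTS A τ) where
  open LTS L

  ⟶⦅τ⦆⇒↠ : ∀ {x y} → _⟶⦅_⦆_ L x τ y → _↠_ L x y
  ⟶⦅τ⦆⇒↠ (inj₁ x⟶y)      = x⟶y ◅ ε
  ⟶⦅τ⦆⇒↠ (inj₂ (_ , refl)) = ε

  CondT-↠ : ∀ {R} → CondT L R → ∀ {s s' t} → R s t → _↠_ L s s' →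
            ∃ λ t' → _↠_ L t t' × R s' t'
  CondT-↠ T sRt ε = _ , ε , sRt
  CondT-↠ T sRt (s⟶s₁ ◅ s₁↠s') with T sRt s⟶s₁
  ... | _ , _ , t↠t'' , t''⟶t₁ , _ , s₁Rt₁ with CondT-↠ T s₁Rt₁ s₁↠s'
  ... | t' , t₁↠t' , s'Rt' = t' , t↠t'' ◅◅ ⟶⦅τ⦆⇒↠ t''⟶t₁ ◅◅ t₁↠t' , s'Rt'

  CondT-⨾ : ∀ {R₁ R₂} → CondT L R₁ → CondT L R₂ → CondT L (R₁ ⨾ R₂)
  CondT-⨾ T₁ T₂ (t , sR₁t , tR₂u) s⟶s' with T₁ sR₁t s⟶s'
  ... | t'' , t' , t↠t'' , t''⟶t' , sR₁t'' , s'R₁t' with CondT-↠ T₂ tR₂u t↠t''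
  ... | u'' , u↠u'' , t''R₂u'' with t''⟶t'
  ... | inj₂ (refl , refl) =
    u'' , u'' , u↠u'' , inj₂ (refl , refl) , (t'' , sR₁t'' , t''R₂u'') , (t'' , s'R₁t' , t''R₂u'')
  ... | inj₁ t''⟶t' with T₂ t''R₂u'' t''⟶t'
  ... | u''' , u' , u''↠u''' , u'''⟶u' , t''R₂u''' , t'R₂u' =
    u''' , u' , u↠u'' ◅◅ u''↠u''' , u'''⟶u' , (t'' , sR₁t'' , t''R₂u''') , (t' , s'R₁t' , t'R₂u')

  CondD3-⨾ : ∀ {R₁ R₂} → CondD3 L R₁ → CondD3 L R₂ → CondD3 L (R₁ ⨾ R₂)
  CondD3-⨾ D₁ D₂ (t , sR₁t , tR₂u) ss ss₀ ss-steps with D₁ sR₁t ss ss₀ ss-steps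
  ... | ts , σ , refl , ts-steps , ssR₁ts with D₂ tR₂u ts refl ts-steps
  ... | us , ρ , us₀ , us-steps , tsR₂us =
    us , σ ∘ ρ , us₀ , us-steps , λ ℓ → ts (ρ ℓ) , ssR₁ts (ρ ℓ) , tsR₂us ℓ

lemma3 : {A : Set} {τ : A} (L : LTS A τ) (R₁ R₂ : LTS.S L → LTS.S L → Set) →
    ((CondT L R₁ → CondT L R₂ → CondT L (R₁ ⨾ R₂))
    × (CondD3 L R₁ → CondD3 L R₂ → CondD3 L (R₁ ⨾ R₂)))
lemma3 L R₁ R₂ = CondT-⨾ L , CondD3-⨾ L
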